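{- Let $A\subseteq\{0,1\}^k$ be a predicate. If $\mathrm{Pol}(\mathrm{fPCSP}(A,\mathrm{OR}))$ contains infinitely many functions from $\{\mathrm{AT}_\ell:\ell\text{ odd}\}$, then it also contains infinitely many functions from at least one of $\{\mathrm{Maj}_\ell:\ell\text{ odd}\}$ or $\{\neg\mathrm{Maj}_\ell:\ell\text{ odd}\}$.
   Context: A predicate is a set $\emptyset\ne A\subsetneq\{0,1\}^k$; $\mathrm{OR}=\{0,1\}^k\setminus\{0^k\}$. A function $f:\{0,1\}^\ell\to\{0,1\}$ is a polymorphism of $\mathrm{PCSP}(A,B)$ if for every $k\times\ell$ matrix $M$ whose columns lie in $A$, the vector of values of $f$ on the rows of $M$ lies in $B$; $\mathrm{Pol}(\mathrm{fPCSP}(A,B))$ is the set of such polymorphisms that are folded ($f(\neg x)=\neg f(x)$). For odd $\ell$: $\mathrm{Maj}_\ell(x)=[w(x)\ge\ell/2]$ with $w(x)$ the number of ones, and $\mathrm{AT}_\ell(x)=[\sum_{i=1}^\ell(-1)^{1+i+x_i}>0]$. -}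

module Defs where

open import Data.Bool using (Bool; true; false; not; if_then_else_)
open import Data.Nat using (ℕ; zero; suc; _+_; _*_; _≤_)
open import Data.Vec.Membership.Propositional using (_∈_)
open import Data.Integer using (ℤ; _<_) renaming (_+_ to _+ℤ_; -_ to -ℤ_)
import Data.Integer as ℤ
open import Data.Vec using (Vec; []; _∷_; map; transpose; toList)
open import Data.Product using (∃; _×_)
open import Relation.Binary.PropositionalEquality using (_≡_)
open import Relation.Nullary using (¬_)

Pred : ℕ → Set
Pred k = Vec Bool k → Bool

IsPredicate : ∀ {k} → Pred k → Set
IsPredicate {k} A = (∃ λ (v : Vec Bool k) → A v ≡ true) × (∃ λ (v : Vec Bool k) → A v ≡ false)

OR : ∀ k → Pred k
OR zero [] = false
OR (suc k) (true ∷ v) = true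
OR (suc k) (false ∷ v) = OR k v

-- Polymorphism of PCSP(A,B): M is given as its k rows (each of length ℓ);
-- its columns are the rows of transpose M.
IsPolymorphism : ∀ {k ℓ} → Pred k → Pred k → (Vec Bool ℓ → Bool) → Set
IsPolymorphism {k} {ℓ} A B f =
  (M : Vec (Vec Bool ℓ) k) →
  (∀ {c} → c ∈ transpose M → A c ≡ true) →
  B (map f M) ≡ true

Folded : ∀ {ℓ} → (Vec Bool ℓ → Bool) → Set
Folded {ℓ} f = (x : Vec Bool ℓ) → f (map not x) ≡ not (f x)

InPolF : ∀ {k ℓ} → Pred k → Pred k → (Vec Bool ℓ → Bool) → Set
InPolF A B f = Folded f × IsPolymorphism A B f

weight : ∀ {n} → Vec Bool n → ℕ
weight [] = 0
weight (true ∷ v) = suc (weight v)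
weight (false ∷ v) = weight v

-- Maj_ℓ(x) = [w(x) ≥ ℓ/2], i.e. [ℓ ≤ 2 w(x)]
Maj : ∀ ℓ → Vec Bool ℓ → Bool
Maj ℓ x with ℓ Data.Nat.≤? 2 * weight x
... | Relation.Nullary.yes _ = true
... | Relation.Nullary.no _ = false

negMaj : ∀ ℓ → Vec Bool ℓ → Bool
negMaj ℓ x = not (Maj ℓ x)

-- (-1)^(1+i+b) for a position i (1-based) and bit b
sgn : ℕ → Bool → ℤ
sgn i b = if parity (suc (i + bit b)) then ℤ.+ 1 else ℤ.- (ℤ.+ 1)
  where
  bit : Bool → ℕ
  bit true = 1
  bit false = 0
  -- true iff the number is even
  parity : ℕ → Bool
  parity zero = true
  parity (suc n) = not (parity n)

altSum : ∀ {n} → ℕ → Vec Bool n → ℤ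
altSum i [] = ℤ.+ 0
altSum i (b ∷ v) = sgn i b +ℤ altSum (suc i) v

AT : ∀ ℓ → Vec Bool ℓ → Bool
AT ℓ x with ℤ.+ 0 ℤ.<? altSum 1 x
... | Relation.Nullary.yes _ = true
... | Relation.Nullary.no _ = false

Odd : ℕ → Set
Odd ℓ = ∃ λ m → ℓ ≡ suc (2 * m)

-- "Pol contains infinitely many members of the family {F_ℓ : ℓ odd}":
-- for every bound N there is an odd ℓ ≥ N with F_ℓ in Pol
-- (members of different arities are distinct functions).
InfinitelyMany : ∀ {k} → Pred k → Pred k → ((ℓ : ℕ) → Vec Bool ℓ → Bool) → Set
InfinitelyMany A B F = ∀ (N : ℕ) → ∃ λ ℓ → N ≤ ℓ × Odd ℓ × InPolF A B (F ℓ)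

-- Write σ(a) ∈ {±1}ᵏ for the sign vector of a ∈ A (true ↦ 1, false ↦ −1). By Ville's theorem
-- of the alternative, either some semipositive integer vector w has w · σ(a) ≥ 0 for all a ∈ A,
-- or some list of elements of A has a sign sum that is negative in every coordinate; the same
-- dichotomy holds for −σ. Ville's theorem is proved by Fourier–Motzkin elimination, which makes
-- the case distinction constructive.
-- In the first case Maj_ℓ is a polymorphism for every odd ℓ: if every row of a matrix with
-- columns in A had a majority of zeros, its sign sums would all be negative, yet weighting row i
-- by wᵢ and summing column by column gives a nonnegative total. The first case for −σ gives ¬Maj_ℓ
-- in the same way. Otherwise there are lists P, Q ⊆ A whose sign sums are negative, resp.
-- positive, in every coordinate. AT_ℓ weighs column j by (−1)ʲ, so placing the pairs of P × Q on
-- the even and odd columns after a fixed a₀ ∈ A, padded with (a₀ , a₀), makes every alternating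
-- row sum nonpositive for all large odd ℓ; AT_ℓ then maps the matrix to 0ᵏ ∉ OR.

module Submission where

open import Defs
open import Data.Bool using (Bool; true; false; not; if_then_else_)
import Data.Bool.Properties as Bool
open import Data.Empty using (⊥-elim)
open import Data.Fin using (Fin; zero; suc)
open import Data.Integer as ℤ using (ℤ; 0ℤ; +_; -[1+_]; -_; _+_; _-_; _*_; _≤_; _<_; +≤+; +<+; -≤+; ∣_∣)
import Data.Integer.Properties as ℤ
open import Data.Integer.Tactic.RingSolver using (solve-∀)
open import Data.List using (List; []; _∷_; _++_; [_]; length; map; concat; replicate; filter; cartesianProduct)
open import Data.List.Membership.Propositional using (_∈_; find; lose)
open import Data.List.Membership.Propositional.Properties
  using (∈-map⁺; ∈-map⁻; ∈-++⁺ˡ; ∈-++⁺ʳ; ∈-++⁻; ∈-concat⁻′; ∈-filter⁺; ∈-filter⁻; ∈-cartesianProduct⁺; ∈-cartesianProduct⁻)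
open import Data.List.Relation.Unary.Any using (here; there; any?)
import Data.List.Relation.Unary.All as All
open import Data.List.Relation.Unary.All.Properties using (++⁺; concat⁺; replicate⁺)
open import Data.List.Relation.Binary.Subset.Propositional using (_⊆_)
open import Data.Nat as ℕ using (ℕ; zero; suc; z≤n; s≤s)
import Data.Nat.Properties as ℕ
open import Data.Product as Product using (∃; ∃₂; _×_; _,_; proj₁; proj₂; uncurry)
open import Data.Rational.Unnormalised as ℚᵘ using (ℚᵘ; mkℚᵘ; ↥_; ↧_; *≤*)
import Data.Rational.Unnormalised.Properties as ℚᵘ
open import Data.Sum as Sum using (_⊎_; inj₁; inj₂)
open import Data.Vec as Vec using (Vec; []; _∷_; lookup; transpose)
import Data.Vec.Properties as Vec
open import Data.Vec.Membership.Propositional.Properties using (∈-lookup)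
open import Data.Vec.Relation.Unary.All as VecAll using ([]; _∷_)
open import Data.Vec.Membership.Propositional using () renaming (_∈_ to _∈ᵥ_)
open import Data.Vec.Functional using (Vector; tail) renaming (_∷_ to _◂_)
open import Function using (_∘_; id; _⇔_; mk⇔; Equivalence; case_of_)
open import Relation.Binary.Definitions using (tri<; tri≈; tri>)
open import Relation.Binary.PropositionalEquality using (_≡_; _≢_; refl; sym; trans; cong; cong₂; subst; module ≡-Reasoning)
open import Relation.Nullary using (yes; no; ¬_)
open import Relation.Nullary.Decidable using (_×-dec_)
open import Relation.Unary using (Decidable)

open import Algebra.Properties.Semiring.Sum ℤ.+-*-semiring
  using (sum; sum-cong-≗; ∑-distrib-+; ∑-comm; *-distribˡ-sum; sum-replicate-zero)
open import Data.List.Extrema ℚᵘ.≤-totalOrder using (min; min≤⊤; min≤xs; argmin-sel)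

private
  variable
    X Y : Set
    k : ℕ

*-nonneg : ∀ {a b} → 0ℤ ≤ a → 0ℤ ≤ b → 0ℤ ≤ a * b
*-nonneg {+ m} {+ n} _ _ = subst (0ℤ ≤_) (ℤ.pos-* m n) (+≤+ z≤n)

*-nonneg-neg : ∀ {a b} → 0ℤ ≤ a → b < 0ℤ → a * b ≤ 0ℤ
*-nonneg-neg {+ m} {b} _ b<0 = subst (+ m * b ≤_) (ℤ.*-zeroʳ (+ m)) (ℤ.*-monoˡ-≤-nonNeg (+ m) (ℤ.<⇒≤ b<0))

*-pos-neg : ∀ {a b} → 0ℤ < a → b < 0ℤ → a * b < 0ℤ
*-pos-neg {+ suc m} {b} _        b<0 = subst (+ suc m * b <_) (ℤ.*-zeroʳ (+ suc m)) (ℤ.*-monoˡ-<-pos (+ suc m) b<0)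
*-pos-neg {+ zero}      (+<+ ()) _

*-pos : ∀ {a b} → 0ℤ < a → 0ℤ < b → 0ℤ < a * b
*-pos {+ suc m} {+ suc n} _        _        = +<+ (s≤s z≤n)
*-pos {+ zero}  {_}       (+<+ ()) _
*-pos {_}       {+ zero}  _        (+<+ ())

i≤0∧j<0⇒j+k*i<0 : ∀ {i j} k → i ≤ 0ℤ → j < 0ℤ → j + + k * i < 0ℤ
i≤0∧j<0⇒j+k*i<0 k i≤0 j<0 = ℤ.+-mono-<-≤ j<0 (ℤ.≤-trans (ℤ.*-monoˡ-≤-nonNeg (+ k) i≤0) (ℤ.≤-reflexive (ℤ.*-zeroʳ (+ k))))

i<0∧j<k⇒j+k*i<0 : ∀ {i j} k → i < 0ℤ → j < + k → j + + k * i < 0ℤ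
i<0∧j<k⇒j+k*i<0 {i} {j} k i<0 j<k = begin-strict
  j + + k * i          <⟨ ℤ.+-monoˡ-< (+ k * i) j<k ⟩
  + k + + k * i        ≤⟨ ℤ.+-monoʳ-≤ (+ k) (ℤ.*-monoˡ-≤-nonNeg (+ k) (ℤ.i<j⇒i≤pred[j] i<0)) ⟩
  + k + + k * -[1+ 0 ] ≡⟨ cancel (+ k) ⟩
  0ℤ                   ∎
  where
  open ℤ.≤-Reasoning
  cancel : ∀ a → a + a * - (+ 1) ≡ 0ℤ
  cancel = solve-∀

∃-strict-upper-bound : ∀ {n} (v : Vector ℤ n) → ∃ λ K → ∀ i → v i < + K
∃-strict-upper-bound {zero}  v = 0 , λ ()
∃-strict-upper-bound {suc n} v with ∃-strict-upper-bound (tail v)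
... | K , bound = suc ∣ v zero ∣ ℕ.+ K , λ
  { zero    → ℤ.<-≤-trans (ℤ.≤-<-trans (i≤+∣i∣ (v zero)) (+<+ ℕ.≤-refl)) (+≤+ (ℕ.m≤m+n _ K))
  ; (suc i) → ℤ.<-≤-trans (bound i) (+≤+ (ℕ.m≤n+m K _)) }
  where
  i≤+∣i∣ : ∀ i → i ≤ + ∣ i ∣
  i≤+∣i∣ (+ n)    = ℤ.≤-refl
  i≤+∣i∣ -[1+ n ] = -≤+

_∙_ : Vector ℤ k → Vector ℤ k → ℤ
w ∙ v = sum (λ i → w i * v i)

sum-nonneg : ∀ {n} (f : Vector ℤ n) → (∀ i → 0ℤ ≤ f i) → 0ℤ ≤ sum f
sum-nonneg {zero}  f _   = ℤ.≤-refl
sum-nonneg {suc n} f f≥0 = ℤ.+-mono-≤ (f≥0 zero) (sum-nonneg (tail f) (f≥0 ∘ suc))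

sum-nonpos : ∀ {n} (f : Vector ℤ n) → (∀ i → f i ≤ 0ℤ) → sum f ≤ 0ℤ
sum-nonpos {zero}  f _   = ℤ.≤-refl
sum-nonpos {suc n} f f≤0 = ℤ.+-mono-≤ (f≤0 zero) (sum-nonpos (tail f) (f≤0 ∘ suc))

sum-neg : ∀ {n} (f : Vector ℤ n) → (∀ i → f i ≤ 0ℤ) → ∀ i → f i < 0ℤ → sum f < 0ℤ
sum-neg f f≤0 zero    f0<0 = ℤ.+-mono-<-≤ f0<0 (sum-nonpos (tail f) (f≤0 ∘ suc))
sum-neg f f≤0 (suc i) fi<0 = ℤ.+-mono-≤-< (f≤0 zero) (sum-neg (tail f) (f≤0 ∘ suc) i fi<0)

sumL : (X → ℤ) → List X → ℤ
sumL f []       = 0ℤ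
sumL f (x ∷ xs) = f x + sumL f xs

sumL-++ : (f : X → ℤ) (xs ys : List X) → sumL f (xs ++ ys) ≡ sumL f xs + sumL f ys
sumL-++ f []       ys = sym (ℤ.+-identityˡ _)
sumL-++ f (x ∷ xs) ys = trans (cong (λ s → f x + s) (sumL-++ f xs ys)) (sym (ℤ.+-assoc (f x) _ _))

sumL-concat : (f : X → ℤ) (xss : List (List X)) → sumL f (concat xss) ≡ sumL (sumL f) xss
sumL-concat f []         = refl
sumL-concat f (xs ∷ xss) = trans (sumL-++ f xs (concat xss)) (cong (λ s → sumL f xs + s) (sumL-concat f xss))

sumL-map : (f : Y → ℤ) (g : X → Y) (xs : List X) → sumL f (map g xs) ≡ sumL (f ∘ g) xs
sumL-map f g []       = refl
sumL-map f g (x ∷ xs) = cong (λ s → f (g x) + s) (sumL-map f g xs)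

sumL-replicate : (f : X → ℤ) (n : ℕ) (x : X) → sumL f (replicate n x) ≡ + n * f x
sumL-replicate f zero    x = refl
sumL-replicate f (suc n) x = begin
  f x + sumL f (replicate n x) ≡⟨ cong (λ s → f x + s) (sumL-replicate f n x) ⟩
  f x + + n * f x              ≡⟨ ℤ.suc-* (+ n) (f x) ⟨
  (+ 1 + + n) * f x            ∎
  where open ≡-Reasoning

sumL-nonpos : (f : X → ℤ) (xs : List X) → (∀ {x} → x ∈ xs → f x ≤ 0ℤ) → sumL f xs ≤ 0ℤ
sumL-nonpos f []       _   = ℤ.≤-refl
sumL-nonpos f (x ∷ xs) f≤0 = ℤ.+-mono-≤ (f≤0 (here refl)) (sumL-nonpos f xs (f≤0 ∘ there))

sumL-cartesianProduct : (f : X → ℤ) (g : Y → ℤ) (xs : List X) (ys : List Y) →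
  sumL (λ p → f (proj₁ p) + g (proj₂ p)) (cartesianProduct xs ys) ≡ + length ys * sumL f xs + + length xs * sumL g ys
sumL-cartesianProduct f g []       ys = sym (cong₂ _+_ (ℤ.*-zeroʳ (+ length ys)) refl)
sumL-cartesianProduct {X = X} {Y} f g (x ∷ xs) ys = begin
  sumL h (map (x ,_) ys ++ cartesianProduct xs ys)
    ≡⟨ sumL-++ h (map (x ,_) ys) _ ⟩
  sumL h (map (x ,_) ys) + sumL h (cartesianProduct xs ys)
    ≡⟨ cong₂ _+_ (trans (sumL-map h (x ,_) ys) (row ys)) (sumL-cartesianProduct f g xs ys) ⟩
  (+ length ys * f x + sumL g ys) + (+ length ys * sumL f xs + + length xs * sumL g ys)
    ≡⟨ regroup (+ length ys) (+ length xs) (f x) (sumL f xs) (sumL g ys) ⟩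
  + length ys * (f x + sumL f xs) + (+ 1 + + length xs) * sumL g ys
    ∎
  where
  open ≡-Reasoning
  h : X × Y → ℤ
  h p = f (proj₁ p) + g (proj₂ p)
  row : ∀ ys → sumL (λ y → f x + g y) ys ≡ + length ys * f x + sumL g ys
  row []       = refl
  row (y ∷ ys) = trans (cong (λ s → f x + g y + s) (row ys)) (regroup′ (f x) (g y) (+ length ys) (sumL g ys))
    where
    regroup′ : ∀ a b n s → a + b + (n * a + s) ≡ (+ 1 + n) * a + (b + s)
    regroup′ = solve-∀
  regroup : ∀ n l a F G → (n * a + G) + (n * F + l * G) ≡ n * (a + F) + (+ 1 + l) * G
  regroup = solve-∀

∙-sumL : (w : Vector ℤ k) (φ : X → Vector ℤ k) (xs : List X) →
         w ∙ (λ i → sumL (λ x → φ x i) xs) ≡ sumL (λ x → w ∙ φ x) xs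
∙-sumL {k = k} w φ [] = trans (sum-cong-≗ (ℤ.*-zeroʳ ∘ w)) (sum-replicate-zero k)
∙-sumL w φ (x ∷ xs) = begin
  sum (λ i → w i * (φ x i + sumL (λ y → φ y i) xs))          ≡⟨ sum-cong-≗ (λ i → ℤ.*-distribˡ-+ (w i) _ _) ⟩
  sum (λ i → w i * φ x i + w i * sumL (λ y → φ y i) xs)      ≡⟨ ∑-distrib-+ (λ i → w i * φ x i) _ ⟩
  w ∙ φ x + w ∙ (λ i → sumL (λ y → φ y i) xs)                ≡⟨ cong (λ s → w ∙ φ x + s) (∙-sumL w φ xs) ⟩
  w ∙ φ x + sumL (λ y → w ∙ φ y) xs                          ∎
  where open ≡-Reasoning

-- Ville's theorem of the alternative

SemiPositive : Vector ℤ k → Set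
SemiPositive w = (∀ i → 0ℤ ≤ w i) × ∃ λ i → 0ℤ < w i

∙-neg : ∀ {w v : Vector ℤ k} → SemiPositive w → (∀ i → v i < 0ℤ) → w ∙ v < 0ℤ
∙-neg {w = w} {v} (w≥0 , i₀ , 0<wi₀) v<0 =
  sum-neg (λ i → w i * v i) (λ i → *-nonneg-neg (w≥0 i) (v<0 i)) i₀ (*-pos-neg 0<wi₀ (v<0 i₀))

SemiPositiveSolution : (X → Vector ℤ k) → List X → Set
SemiPositiveSolution φ S = ∃ λ w → SemiPositive w × (∀ {s} → s ∈ S → 0ℤ ≤ w ∙ φ s)

NegativeCombination : (X → Vector ℤ k) → List X → Set
NegativeCombination φ S = ∃ λ L → L ⊆ S × (∀ i → sumL (λ x → φ x i) L < 0ℤ)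

module _ (h B : X → ℤ) (S : List X)
  (B≥0 : ∀ {s} → s ∈ S → h s ≤ 0ℤ → 0ℤ ≤ B s)
  (mixed≥0 : ∀ {u v} → u ∈ S → v ∈ S → 0ℤ < h u → h v < 0ℤ → 0ℤ ≤ - h v * B u + h u * B v)
  where

  private
    -- B x / h x when 0 < h x, the only case in which it is used.
    ratio : X → ℚᵘ
    ratio x = mkℚᵘ (B x) (ℕ.pred ∣ h x ∣)

    ↧ratio : ∀ {x} → 0ℤ < h x → ↧ ratio x ≡ h x
    ↧ratio {x} 0<hx with h x | 0<hx
    ... | + suc n | _      = refl
    ... | + zero  | +<+ ()

    positive? : Decidable (λ x → 0ℤ < h x)
    positive? x = 0ℤ ℤ.<? h x

    P : List X
    P = filter positive? S

    ∈P⁻ : ∀ {x} → x ∈ P → x ∈ S × 0ℤ < h x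
    ∈P⁻ = ∈-filter⁻ positive?

    ∈P⁺ : ∀ {x} → x ∈ S → 0ℤ < h x → x ∈ P
    ∈P⁺ = ∈-filter⁺ positive?

    r : ℚᵘ
    r = min ℚᵘ.0ℚᵘ (map ratio P)

    r≤0 : ↥ r ≤ 0ℤ
    r≤0 with min≤⊤ ℚᵘ.0ℚᵘ (map ratio P)
    ... | *≤* le = subst (_≤ 0ℤ) (ℤ.*-identityʳ (↥ r)) le

    r≤ratio : ∀ {s} → s ∈ S → 0ℤ < h s → ↥ r * h s ≤ B s * ↧ r
    r≤ratio {s} s∈S 0<hs with All.lookup (min≤xs ℚᵘ.0ℚᵘ (map ratio P)) (∈-map⁺ ratio (∈P⁺ s∈S 0<hs))
    ... | *≤* le = subst (λ d → ↥ r * d ≤ B s * ↧ r) (↧ratio 0<hs) le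

    bound-negative : ∀ {q} → q ≡ ℚᵘ.0ℚᵘ ⊎ q ∈ map ratio P →
                     ∀ {s} → s ∈ S → h s < 0ℤ → 0ℤ ≤ - ↥ q * h s + ↧ q * B s
    bound-negative (inj₁ refl) {s} s∈S hs<0 =
      subst (0ℤ ≤_) (sym (trans (ℤ.+-identityˡ (+ 1 * B s)) (ℤ.*-identityˡ (B s)))) (B≥0 s∈S (ℤ.<⇒≤ hs<0))
    bound-negative (inj₂ q∈) {s} s∈S hs<0 with ∈-map⁻ ratio q∈
    ... | m , m∈P , refl with ∈P⁻ m∈P
    ...   | m∈S , 0<hm = subst (λ d → 0ℤ ≤ - B m * h s + d * B s) (sym (↧ratio 0<hm))
              (subst (0ℤ ≤_) (swap (B m) (h s) (h m * B s)) (mixed≥0 m∈S s∈S 0<hm hs<0))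
      where
      swap : ∀ a b c → - b * a + c ≡ - a * b + c
      swap = solve-∀

  -- With r = min (0 , min {B x / h x ∣ 0 < h x}), the pair (c , d) = (−↥ r , ↧ r) works: for
  -- h s > 0 by minimality of r, for h s = 0 since B s ≥ 0, and for h s < 0 because r is 0 or
  -- some B m / h m with 0 < h m, where mixed≥0 applies.
  fourierMotzkin : ∃₂ λ c d → 0ℤ ≤ c × 0ℤ < d × (∀ {s} → s ∈ S → 0ℤ ≤ c * h s + d * B s)
  fourierMotzkin = - ↥ r , ↧ r , ℤ.neg-mono-≤ r≤0 , +<+ (s≤s z≤n) , bound
    where
    bound : ∀ {s} → s ∈ S → 0ℤ ≤ - ↥ r * h s + ↧ r * B s
    bound {s} s∈S with ℤ.<-cmp (h s) 0ℤ
    ... | tri< hs<0 _ _ = bound-negative (argmin-sel id ℚᵘ.0ℚᵘ (map ratio P)) s∈S hs<0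
    ... | tri≈ _ hs≡0 _ = begin
      0ℤ                      ≤⟨ *-nonneg {↧ r} (+≤+ z≤n) (B≥0 s∈S (ℤ.≤-reflexive hs≡0)) ⟩
      ↧ r * B s               ≡⟨ ℤ.+-identityˡ (↧ r * B s) ⟨
      0ℤ + ↧ r * B s          ≡⟨ cong (_+ ↧ r * B s) (ℤ.*-zeroʳ (- ↥ r)) ⟨
      - ↥ r * 0ℤ + ↧ r * B s  ≡⟨ cong (λ z → - ↥ r * z + ↧ r * B s) hs≡0 ⟨
      - ↥ r * h s + ↧ r * B s ∎
      where open ℤ.≤-Reasoning
    ... | tri> _ _ 0<hs = subst (0ℤ ≤_) (rearrange (↧ r) (B s) (↥ r) (h s)) (ℤ.i≤j⇒0≤j-i (r≤ratio s∈S 0<hs))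
      where
      rearrange : ∀ d b n a → b * d - n * a ≡ - n * a + d * b
      rearrange = solve-∀

-- One Fourier–Motzkin step, eliminating the first coordinate h: T consists of the singletons
-- [ u ] with h u ≤ 0 and, for h u > 0 > h v, the combination ∣h v∣ u + ∣h u∣ v, whose first
-- coordinate cancels.
module Elimination (φ : X → Vector ℤ (suc k)) (S : List X) where

  h : X → ℤ
  h x = φ x zero

  t : X → Vector ℤ k
  t x = tail (φ x)

  pair : X → X → List X
  pair u v = replicate (∣ h v ∣) u ++ replicate (∣ h u ∣) v

  nonpos? : Decidable (λ u → h u ≤ 0ℤ)
  nonpos? u = h u ℤ.≤? 0ℤ

  opposite? : Decidable (λ ((u , v) : X × X) → 0ℤ < h u × h v < 0ℤ)
  opposite? (u , v) = 0ℤ ℤ.<? h u ×-dec h v ℤ.<? 0ℤ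

  T : List (List X)
  T = map [_] (filter nonpos? S) ++ map (uncurry pair) (filter opposite? (cartesianProduct S S))

  φ' : List X → Vector ℤ k
  φ' b i = sumL (λ x → t x i) b

  sumL-pair : (f : X → ℤ) {u v : X} → 0ℤ < h u → h v < 0ℤ → sumL f (pair u v) ≡ - h v * f u + h u * f v
  sumL-pair f {u} {v} 0<hu hv<0 = begin
    sumL f (pair u v)                                               ≡⟨ sumL-++ f (replicate (∣ h v ∣) u) _ ⟩
    sumL f (replicate (∣ h v ∣) u) + sumL f (replicate (∣ h u ∣) v) ≡⟨ cong₂ _+_ (sumL-replicate f (∣ h v ∣) u) (sumL-replicate f (∣ h u ∣) v) ⟩
    + ∣ h v ∣ * f u + + ∣ h u ∣ * f v                                ≡⟨ cong₂ (λ a b → a * f u + b * f v) (+∣i∣≡-i hv<0) (ℤ.0≤i⇒+∣i∣≡i (ℤ.<⇒≤ 0<hu)) ⟩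
    - h v * f u + h u * f v                                          ∎
    where
    open ≡-Reasoning
    +∣i∣≡-i : ∀ {i} → i < 0ℤ → + ∣ i ∣ ≡ - i
    +∣i∣≡-i { -[1+ n ]} _        = refl
    +∣i∣≡-i {+ n}       (+<+ ())

  single∈T : ∀ {u} → u ∈ S → h u ≤ 0ℤ → [ u ] ∈ T
  single∈T u∈S hu≤0 = ∈-++⁺ˡ (∈-map⁺ [_] (∈-filter⁺ nonpos? u∈S hu≤0))

  pair∈T : ∀ {u v} → u ∈ S → v ∈ S → 0ℤ < h u → h v < 0ℤ → pair u v ∈ T
  pair∈T u∈S v∈S 0<hu hv<0 = ∈-++⁺ʳ (map [_] (filter nonpos? S))
    (∈-map⁺ (uncurry pair) (∈-filter⁺ opposite? (∈-cartesianProduct⁺ u∈S v∈S) (0<hu , hv<0)))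

  ∈T⁻ : ∀ {b} → b ∈ T → b ⊆ S × sumL h b ≤ 0ℤ
  ∈T⁻ b∈T with ∈-++⁻ (map [_] (filter nonpos? S)) b∈T
  ... | inj₁ b∈singles with ∈-map⁻ [_] b∈singles
  ...   | u , u∈ , refl with ∈-filter⁻ nonpos? u∈
  ...     | u∈S , hu≤0 = (λ { (here refl) → u∈S }) , subst (_≤ 0ℤ) (sym (ℤ.+-identityʳ (h u))) hu≤0
  ∈T⁻ b∈T | inj₂ b∈pairs with ∈-map⁻ (uncurry pair) b∈pairs
  ... | (u , v) , uv∈ , refl with ∈-filter⁻ opposite? uv∈
  ...   | uv∈S² , 0<hu , hv<0 with ∈-cartesianProduct⁻ S S uv∈S²
  ...     | u∈S , v∈S = All.lookup (++⁺ (replicate⁺ (∣ h v ∣) u∈S) (replicate⁺ (∣ h u ∣) v∈S))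
                      , ℤ.≤-reflexive (trans (sumL-pair h 0<hu hv<0) (cancel (h u) (h v)))
    where
    cancel : ∀ a b → - b * a + a * b ≡ 0ℤ
    cancel = solve-∀

  -- K copies of L have first coordinate ≤ 0 and all others ≤ −K, which absorbs v₀.
  liftCombination : ∀ {v₀} → v₀ ∈ S → h v₀ < 0ℤ → NegativeCombination φ' T → NegativeCombination φ S
  liftCombination {v₀} v₀∈S hv₀<0 (L' , L'⊆T , L'<0) = v₀ ∷ concat (replicate K L) , lifted⊆S , lifted<0
    where
    L : List X
    L = concat L'

    L⊆S : L ⊆ S
    L⊆S x∈L with ∈-concat⁻′ L' x∈L
    ... | b , x∈b , b∈L' = proj₁ (∈T⁻ (L'⊆T b∈L')) x∈b

    K : ℕ
    K = proj₁ (∃-strict-upper-bound (t v₀))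

    lifted⊆S : v₀ ∷ concat (replicate K L) ⊆ S
    lifted⊆S (here refl) = v₀∈S
    lifted⊆S (there x∈) = All.lookup (concat⁺ (replicate⁺ K (All.tabulate L⊆S))) x∈

    lifted-sum : ∀ i → sumL (λ x → φ x i) (v₀ ∷ concat (replicate K L)) ≡ φ v₀ i + + K * sumL (λ x → φ x i) L
    lifted-sum i = cong (λ s → φ v₀ i + s) (trans (sumL-concat _ (replicate K L)) (sumL-replicate _ K L))

    lifted<0 : ∀ i → sumL (λ x → φ x i) (v₀ ∷ concat (replicate K L)) < 0ℤ
    lifted<0 zero = subst (_< 0ℤ) (sym (lifted-sum zero)) (i≤0∧j<0⇒j+k*i<0 K hL≤0 hv₀<0)
      where
      hL≤0 : sumL h L ≤ 0ℤ
      hL≤0 = subst (_≤ 0ℤ) (sym (sumL-concat h L')) (sumL-nonpos (sumL h) L' (proj₂ ∘ ∈T⁻ ∘ L'⊆T))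
    lifted<0 (suc i) = subst (_< 0ℤ) (sym (lifted-sum (suc i)))
      (i<0∧j<k⇒j+k*i<0 K (subst (_< 0ℤ) (sym (sumL-concat _ L')) (L'<0 i)) (proj₂ (∃-strict-upper-bound (t v₀)) i))

  liftSolution : SemiPositiveSolution φ' T → SemiPositiveSolution φ S
  liftSolution (w' , (w'≥0 , i₀ , 0<w'i₀) , w'-sol) =
    let c , d , 0≤c , 0<d , sol = fourierMotzkin h B S B≥0 mixed≥0
    in  (c ◂ λ i → d * w' i)
      , ((λ { zero → 0≤c ; (suc i) → *-nonneg (ℤ.<⇒≤ 0<d) (w'≥0 i) }) , suc i₀ , *-pos 0<d 0<w'i₀)
      , λ s∈S → subst (0ℤ ≤_) (sym (∙-split c d _)) (sol s∈S)
    where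
    B : X → ℤ
    B x = w' ∙ t x

    sumL-B≥0 : ∀ {b} → b ∈ T → 0ℤ ≤ sumL B b
    sumL-B≥0 {b} b∈T = subst (0ℤ ≤_) (∙-sumL w' t b) (w'-sol b∈T)

    B≥0 : ∀ {s} → s ∈ S → h s ≤ 0ℤ → 0ℤ ≤ B s
    B≥0 s∈S hs≤0 = subst (0ℤ ≤_) (ℤ.+-identityʳ _) (sumL-B≥0 (single∈T s∈S hs≤0))

    mixed≥0 : ∀ {u v} → u ∈ S → v ∈ S → 0ℤ < h u → h v < 0ℤ → 0ℤ ≤ - h v * B u + h u * B v
    mixed≥0 u∈S v∈S 0<hu hv<0 = subst (0ℤ ≤_) (sumL-pair B 0<hu hv<0) (sumL-B≥0 (pair∈T u∈S v∈S 0<hu hv<0))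

    ∙-split : ∀ c d s → (c ◂ λ i → d * w' i) ∙ φ s ≡ c * h s + d * B s
    ∙-split c d s = cong (λ z → c * h s + z)
      (trans (sum-cong-≗ (λ i → ℤ.*-assoc d (w' i) (t s i))) (sym (*-distribˡ-sum d (λ i → w' i * t s i))))

ville : ∀ k (φ : X → Vector ℤ k) (S : List X) → SemiPositiveSolution φ S ⊎ NegativeCombination φ S
ville zero    φ S = inj₂ ([] , (λ ()) , λ ())
ville (suc k) φ S with any? (λ s → φ s zero ℤ.<? 0ℤ) S
... | yes some = let v₀ , v₀∈S , hv₀<0 = find some in
  Sum.map liftSolution (liftCombination v₀∈S hv₀<0) (ville k φ' T)
  where open Elimination φ S
... | no none = inj₁ ((+ 1 ◂ λ _ → 0ℤ) , ((λ { zero → +≤+ z≤n ; (suc i) → ℤ.≤-refl }) , zero , +<+ (s≤s z≤n)) , e₀-sol)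
  where
  e₀-sol : ∀ {s} → s ∈ S → 0ℤ ≤ (+ 1 ◂ λ _ → 0ℤ) ∙ φ s
  e₀-sol {s} s∈S = subst (0ℤ ≤_) (sym e₀∙φs) (ℤ.≮⇒≥ (λ φs<0 → none (lose s∈S φs<0)))
    where
    e₀∙φs : (+ 1 ◂ λ _ → 0ℤ) ∙ φ s ≡ φ s zero
    e₀∙φs = trans (cong₂ _+_ (ℤ.*-identityˡ (φ s zero)) (sum-replicate-zero k)) (ℤ.+-identityʳ (φ s zero))

lookup-transpose : ∀ {A : Set} {m n} (M : Vec (Vec A n) m) j → lookup (transpose M) j ≡ Vec.map (λ r → lookup r j) M
lookup-transpose {n = n} []      j = Vec.lookup-replicate j []
lookup-transpose {n = n} (r ∷ M) j = begin
  lookup (Vec.replicate n Vec._∷_ Vec.⊛ r Vec.⊛ transpose M) j        ≡⟨ Vec.lookup-⊛ j (Vec.replicate n Vec._∷_ Vec.⊛ r) (transpose M) ⟩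
  lookup (Vec.replicate n Vec._∷_ Vec.⊛ r) j (lookup (transpose M) j) ≡⟨ cong (λ f → f (lookup (transpose M) j)) (Vec.lookup-⊛ j (Vec.replicate n Vec._∷_) r) ⟩
  lookup (Vec.replicate n Vec._∷_) j (lookup r j) (lookup (transpose M) j)
    ≡⟨ cong (λ c → c (lookup r j) (lookup (transpose M) j)) (Vec.lookup-replicate j Vec._∷_) ⟩
  lookup r j ∷ lookup (transpose M) j                              ≡⟨ cong (lookup r j ∷_) (lookup-transpose M j) ⟩
  lookup r j ∷ Vec.map (λ r → lookup r j) M                        ∎
  where open ≡-Reasoning

lookup-lookup-transpose : ∀ {A : Set} {m n} (M : Vec (Vec A n) m) i j → lookup (lookup (transpose M) j) i ≡ lookup (lookup M i) j
lookup-lookup-transpose M i j = trans (cong (λ c → lookup c i) (lookup-transpose M j)) (Vec.lookup-map i _ M)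

lookup-ext : ∀ {A : Set} {n} {xs ys : Vec A n} → (∀ i → lookup xs i ≡ lookup ys i) → xs ≡ ys
lookup-ext {xs = xs} {ys} eq = trans (sym (Vec.tabulate∘lookup xs)) (trans (Vec.tabulate-cong eq) (Vec.tabulate∘lookup ys))

transpose-involutive : ∀ {A : Set} {m n} (M : Vec (Vec A n) m) → transpose (transpose M) ≡ M
transpose-involutive M = lookup-ext λ j → lookup-ext λ i →
  trans (lookup-lookup-transpose (transpose M) i j) (lookup-lookup-transpose M j i)

OR≡false⇒ : ∀ {k} (v : Vec Bool k) → OR k v ≡ false → ∀ i → lookup v i ≡ false
OR≡false⇒ (false ∷ v) _  zero    = refl
OR≡false⇒ (false ∷ v) eq (suc i) = OR≡false⇒ v eq i

OR≡false⇐ : ∀ {k} (v : Vec Bool k) → (∀ i → lookup v i ≡ false) → OR k v ≡ false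
OR≡false⇐ []          _       = refl
OR≡false⇐ (false ∷ v) v≡false = OR≡false⇐ v (v≡false ∘ suc)
OR≡false⇐ (true ∷ v)  v≡false with v≡false zero
... | ()

solution⇒polymorphism : ∀ {ℓ} (A : Pred k) (g : Bool → ℤ) {w : Vector ℤ k} → SemiPositive w →
  (∀ a → A a ≡ true → 0ℤ ≤ w ∙ (g ∘ lookup a)) →
  (f : Vec Bool ℓ → Bool) → (∀ x → f x ≡ false → sum (g ∘ lookup x) < 0ℤ) →
  IsPolymorphism A (OR k) f
solution⇒polymorphism {k} {ℓ} A g {w} w-semipos w-sol f f≡false⇒ M cols∈A with OR k (Vec.map f M) in eq
... | true  = refl
... | false = ⊥-elim (ℤ.<⇒≱ total<0 0≤total)
  where
  entry : Fin k → Fin ℓ → ℤ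
  entry i j = g (lookup (lookup M i) j)

  total<0 : w ∙ (sum ∘ entry) < 0ℤ
  total<0 = ∙-neg w-semipos λ i → f≡false⇒ (lookup M i) (trans (sym (Vec.lookup-map i f M)) (OR≡false⇒ _ eq i))

  by-columns : w ∙ (sum ∘ entry) ≡ sum (λ j → w ∙ (g ∘ lookup (lookup (transpose M) j)))
  by-columns = begin
    sum (λ i → w i * sum (entry i))          ≡⟨ sum-cong-≗ (λ i → *-distribˡ-sum (w i) (entry i)) ⟩
    sum (λ i → sum (λ j → w i * entry i j))  ≡⟨ ∑-comm (λ i j → w i * entry i j) ⟩
    sum (λ j → sum (λ i → w i * entry i j))  ≡⟨ sum-cong-≗ (λ j → sum-cong-≗ (λ i → cong (λ b → w i * g b) (lookup-lookup-transpose M i j))) ⟨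
    sum (λ j → w ∙ (g ∘ lookup (lookup (transpose M) j))) ∎
    where open ≡-Reasoning

  0≤total : 0ℤ ≤ w ∙ (sum ∘ entry)
  0≤total = subst (0ℤ ≤_) (sym by-columns) (sum-nonneg _ λ j → w-sol _ (cols∈A (∈-lookup j (transpose M))))

-- Majority

sign : Bool → ℤ
sign true  = + 1
sign false = -[1+ 0 ]

Σsign : ∀ {ℓ} → Vec Bool ℓ → ℤ
Σsign x = sum (sign ∘ lookup x)

Σsign≡ : ∀ {ℓ} (x : Vec Bool ℓ) → Σsign x ≡ + 2 * + weight x - + ℓ
Σsign≡ []          = refl
Σsign≡ {suc ℓ} (true ∷ x) = trans (cong (λ s → + 1 + s) (Σsign≡ x)) (step (+ weight x) (+ ℓ))
  where
  step : ∀ w l → + 1 + (+ 2 * w - l) ≡ + 2 * (+ 1 + w) - (+ 1 + l)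
  step = solve-∀
Σsign≡ {suc ℓ} (false ∷ x) = trans (cong (λ s → -[1+ 0 ] + s) (Σsign≡ x)) (step (+ weight x) (+ ℓ))
  where
  step : ∀ w l → - + 1 + (+ 2 * w - l) ≡ + 2 * w - (+ 1 + l)
  step = solve-∀

Σsign-not : ∀ {ℓ} (x : Vec Bool ℓ) → Σsign (Vec.map not x) ≡ - Σsign x
Σsign-not []      = refl
Σsign-not (b ∷ x) = trans (cong₂ _+_ (sign-not b) (Σsign-not x)) (sym (ℤ.neg-distrib-+ (sign b) (Σsign x)))
  where
  sign-not : ∀ b → sign (not b) ≡ - sign b
  sign-not true  = refl
  sign-not false = refl

Σsign≢0 : ∀ {ℓ} → Odd ℓ → (x : Vec Bool ℓ) → Σsign x ≢ 0ℤ
Σsign≢0 (m , refl) x Σ≡0 = ℕ.even≢odd (weight x) m (ℤ.+-injective (begin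
  + (2 ℕ.* weight x)      ≡⟨ ℤ.pos-* 2 (weight x) ⟩
  + 2 * + weight x        ≡⟨ ℤ.i-j≡0⇒i≡j _ _ (trans (sym (Σsign≡ x)) Σ≡0) ⟩
  + suc (2 ℕ.* m)         ∎))
  where open ≡-Reasoning

0≤Σsign⇔ : ∀ {ℓ} (x : Vec Bool ℓ) → 0ℤ ≤ Σsign x ⇔ ℓ ℕ.≤ 2 ℕ.* weight x
0≤Σsign⇔ {ℓ} x = mk⇔
  (λ 0≤Σ → ℤ.drop‿+≤+ (subst (+ ℓ ≤_) (sym (ℤ.pos-* 2 (weight x))) (ℤ.0≤i-j⇒j≤i (subst (0ℤ ≤_) (Σsign≡ x) 0≤Σ))))
  (λ ℓ≤2w → subst (0ℤ ≤_) (sym (Σsign≡ x)) (ℤ.i≤j⇒0≤j-i (subst (+ ℓ ≤_) (ℤ.pos-* 2 (weight x)) (+≤+ ℓ≤2w))))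

Maj≡true : ∀ {ℓ} (x : Vec Bool ℓ) → 0ℤ ≤ Σsign x → Maj ℓ x ≡ true
Maj≡true {ℓ} x 0≤Σ with ℓ ℕ.≤? 2 ℕ.* weight x
... | yes _    = refl
... | no ℓ≰2w = ⊥-elim (ℓ≰2w (Equivalence.to (0≤Σsign⇔ x) 0≤Σ))

Maj≡false : ∀ {ℓ} (x : Vec Bool ℓ) → Σsign x < 0ℤ → Maj ℓ x ≡ false
Maj≡false {ℓ} x Σ<0 with ℓ ℕ.≤? 2 ℕ.* weight x
... | yes ℓ≤2w = ⊥-elim (ℤ.<⇒≱ Σ<0 (Equivalence.from (0≤Σsign⇔ x) ℓ≤2w))
... | no _     = refl

Maj≡false⇒Σsign<0 : ∀ {ℓ} (x : Vec Bool ℓ) → Maj ℓ x ≡ false → Σsign x < 0ℤ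
Maj≡false⇒Σsign<0 x eq = ℤ.≰⇒> λ 0≤Σ → case trans (sym (Maj≡true x 0≤Σ)) eq of λ ()

Maj-folded : ∀ {ℓ} → Odd ℓ → Folded (Maj ℓ)
Maj-folded odd x with ℤ.<-cmp (Σsign x) 0ℤ
... | tri< Σ<0 _ _ = trans (Maj≡true  (Vec.map not x) (subst (0ℤ ≤_) (sym (Σsign-not x)) (ℤ.<⇒≤ (ℤ.neg-mono-< Σ<0))))
                           (cong not (sym (Maj≡false x Σ<0)))
... | tri≈ _ Σ≡0 _ = ⊥-elim (Σsign≢0 odd x Σ≡0)
... | tri> _ _ 0<Σ = trans (Maj≡false (Vec.map not x) (subst (_< 0ℤ) (sym (Σsign-not x)) (ℤ.neg-mono-< 0<Σ)))
                           (cong not (sym (Maj≡true x (ℤ.<⇒≤ 0<Σ))))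

allVecs : ∀ k → List (Vec Bool k)
allVecs zero    = [ [] ]
allVecs (suc k) = map (Vec._∷_ true) (allVecs k) ++ map (Vec._∷_ false) (allVecs k)

∈-allVecs : ∀ {k} (v : Vec Bool k) → v ∈ allVecs k
∈-allVecs []          = here refl
∈-allVecs (true ∷ v)  = ∈-++⁺ˡ (∈-map⁺ (Vec._∷_ true) (∈-allVecs v))
∈-allVecs {suc k} (false ∷ v) = ∈-++⁺ʳ (map (Vec._∷_ true) (allVecs k)) (∈-map⁺ (Vec._∷_ false) (∈-allVecs v))

module _ (A : Pred k) where

  satisfying : List (Vec Bool k)
  satisfying = filter (λ a → A a Bool.≟ true) (allVecs k)

  ∈-satisfying⁺ : ∀ {a} → A a ≡ true → a ∈ satisfying
  ∈-satisfying⁺ {a} = ∈-filter⁺ (λ a → A a Bool.≟ true) (∈-allVecs a)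

  ∈-satisfying⁻ : ∀ {a} → a ∈ satisfying → A a ≡ true
  ∈-satisfying⁻ = proj₂ ∘ ∈-filter⁻ (λ a → A a Bool.≟ true) {xs = allVecs k}

  Maj∈Pol : SemiPositiveSolution (λ a → sign ∘ lookup a) satisfying → ∀ {ℓ} → Odd ℓ → InPolF A (OR k) (Maj ℓ)
  Maj∈Pol (w , w-semipos , w-sol) odd =
    Maj-folded odd , solution⇒polymorphism A sign w-semipos (λ _ → w-sol ∘ ∈-satisfying⁺) (Maj _) Maj≡false⇒Σsign<0

  negMaj∈Pol : SemiPositiveSolution (λ a → sign ∘ not ∘ lookup a) satisfying → ∀ {ℓ} → Odd ℓ → InPolF A (OR k) (negMaj ℓ)
  negMaj∈Pol (w , w-semipos , w-sol) odd =
    cong not ∘ Maj-folded odd , solution⇒polymorphism A (sign ∘ not) w-semipos (λ _ → w-sol ∘ ∈-satisfying⁺) (negMaj _) negMaj≡false⇒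
    where
    negMaj≡false⇒ : ∀ x → negMaj _ x ≡ false → sum (sign ∘ not ∘ lookup x) < 0ℤ
    negMaj≡false⇒ x eq = subst (_< 0ℤ) (sum-cong-≗ (λ j → cong sign (Vec.lookup-map j not x)))
      (Maj≡false⇒Σsign<0 (Vec.map not x) (trans (Maj-folded odd x) eq))

everyOdd⇒InfinitelyMany : {A B : Pred k} (F : (ℓ : ℕ) → Vec Bool ℓ → Bool) →
  (∀ {ℓ} → Odd ℓ → InPolF A B (F ℓ)) → InfinitelyMany A B F
everyOdd⇒InfinitelyMany F F∈Pol N = suc (2 ℕ.* N) , ℕ.≤-trans (ℕ.m≤m+n N _) (ℕ.n≤1+n _) , (N , refl) , F∈Pol (N , refl)

-- Alternating threshold

sgn-periodic : ∀ i b → sgn (suc (suc i)) b ≡ sgn i b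
sgn-periodic i b = cong (λ p → if p then + 1 else - + 1) (Bool.not-involutive _)

altSum-periodic : ∀ {n} i (x : Vec Bool n) → altSum (suc (suc i)) x ≡ altSum i x
altSum-periodic i []      = refl
altSum-periodic i (b ∷ x) = cong₂ _+_ (sgn-periodic i b) (altSum-periodic (suc i) x)

sgn-odd : ∀ b → sgn 1 b ≡ sign (not b)
sgn-odd true  = refl
sgn-odd false = refl

sgn-even : ∀ b → sgn 2 b ≡ sign b
sgn-even true  = refl
sgn-even false = refl

altSum-pair : ∀ {n} (a b : Bool) (x : Vec Bool n) → altSum 2 (a ∷ b ∷ x) ≡ sign a + sign (not b) + altSum 2 x
altSum-pair a b x = trans
  (cong₂ _+_ (sgn-even a) (cong₂ _+_ (trans (sgn-periodic 1 b) (sgn-odd b)) (altSum-periodic 2 x)))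
  (sym (ℤ.+-assoc (sign a) _ _))

AT≡false : ∀ {ℓ} (x : Vec Bool ℓ) → altSum 1 x ≤ 0ℤ → AT ℓ x ≡ false
AT≡false x alt≤0 with 0ℤ ℤ.<? altSum 1 x
... | yes 0<alt = ⊥-elim (ℤ.<⇒≱ 0<alt alt≤0)
... | no _      = refl

Pair : ℕ → Set
Pair k = Vec Bool k × Vec Bool k

pairSign : Fin k → Pair k → ℤ
pairSign i (x , y) = sign (lookup x i) + sign (not (lookup y i))

NegativePairing : List (Vec Bool k) → Set
NegativePairing S = ∃ λ ps → (∀ {x y} → (x , y) ∈ ps → x ∈ S × y ∈ S) × (∀ i → sumL (pairSign i) ps < 0ℤ)

balancedPairs : {S : List (Vec Bool k)} →
  NegativeCombination (λ a → sign ∘ lookup a) S → NegativeCombination (λ a → sign ∘ not ∘ lookup a) S →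
  NegativePairing S
balancedPairs (LP , LP⊆S , LP<0) (LQ , LQ⊆S , LQ<0) =
  cartesianProduct LP LQ ,
  (λ xy∈ → Product.map LP⊆S LQ⊆S (∈-cartesianProduct⁻ LP LQ xy∈)) ,
  λ i → subst (_< 0ℤ) (sym (sumL-cartesianProduct (λ x → sign (lookup x i)) (λ y → sign (not (lookup y i))) LP LQ))
    (ℤ.+-mono-≤-< (*-nonneg-neg {+ length LQ} (+≤+ z≤n) (LP<0 i)) (*-pos-neg (nonempty LP (LP<0 i)) (LQ<0 i)))
  where
  nonempty : ∀ {f : Vec Bool _ → ℤ} L → sumL f L < 0ℤ → 0ℤ < + length L
  nonempty []      (+<+ ())
  nonempty (_ ∷ _) _ = +<+ (s≤s z≤n)

module _ (s₀ : Vec Bool k) where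

  -- With s₀ in column 1, the pair (x , y) lands in columns (2j , 2j + 1), where AT weighs x by
  -- sign and y by − sign (altSum-pair); the padding pairs (s₀ , s₀) contribute 0.
  flattenPadded : ∀ m → List (Pair k) → Vec (Vec Bool k) (m ℕ.* 2)
  flattenPadded zero    _              = []
  flattenPadded (suc m) []             = s₀ ∷ s₀ ∷ flattenPadded m []
  flattenPadded (suc m) ((x , y) ∷ ps) = x ∷ y ∷ flattenPadded m ps

  altSum-flattenPadded : ∀ m ps i → length ps ℕ.≤ m →
    altSum 2 (Vec.map (λ c → lookup c i) (flattenPadded m ps)) ≡ sumL (pairSign i) ps
  altSum-flattenPadded zero    []             i _  = refl
  altSum-flattenPadded (suc m) []             i _  = begin
    altSum 2 (lookup s₀ i ∷ lookup s₀ i ∷ rest) ≡⟨ altSum-pair (lookup s₀ i) (lookup s₀ i) rest ⟩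
    pairSign i (s₀ , s₀) + altSum 2 rest        ≡⟨ cong₂ _+_ (cancel (lookup s₀ i)) (altSum-flattenPadded m [] i z≤n) ⟩
    0ℤ                                          ∎
    where
    open ≡-Reasoning
    rest : Vec Bool (m ℕ.* 2)
    rest = Vec.map (λ c → lookup c i) (flattenPadded m [])
    cancel : ∀ b → sign b + sign (not b) ≡ 0ℤ
    cancel true  = refl
    cancel false = refl
  altSum-flattenPadded (suc m) ((x , y) ∷ ps) i (s≤s len≤m) =
    trans (altSum-pair (lookup x i) (lookup y i) (Vec.map (λ c → lookup c i) (flattenPadded m ps)))
          (cong (λ s → pairSign i (x , y) + s) (altSum-flattenPadded m ps i len≤m))

  flattenPadded-All : {Q : Vec Bool k → Set} → Q s₀ → ∀ m {ps} → (∀ {x y} → (x , y) ∈ ps → Q x × Q y) →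
                      VecAll.All Q (flattenPadded m ps)
  flattenPadded-All Qs₀ zero                     _   = []
  flattenPadded-All Qs₀ (suc m) {[]}             _   = Qs₀ ∷ Qs₀ ∷ flattenPadded-All Qs₀ m λ ()
  flattenPadded-All Qs₀ (suc m) {(x , y) ∷ ps} Qps =
    proj₁ (Qps (here refl)) ∷ proj₂ (Qps (here refl)) ∷ flattenPadded-All Qs₀ m (Qps ∘ there)

  AT∉Pol : (A : Pred k) → A s₀ ≡ true → ∀ {m} (ps : List (Pair k)) → length ps ℕ.≤ m →
           (∀ {x y} → (x , y) ∈ ps → A x ≡ true × A y ≡ true) → (∀ i → sumL (pairSign i) ps < 0ℤ) →
           ¬ IsPolymorphism A (OR k) (AT (suc (m ℕ.* 2)))
  AT∉Pol A s₀∈A {m} ps len≤m ps⊆A ps<0 AT∈Pol = case trans (sym (AT∈Pol M columns∈A)) (OR≡false⇐ _ rows-false) of λ ()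
    where
    C : Vec (Vec Bool k) (suc (m ℕ.* 2))
    C = s₀ ∷ flattenPadded m ps

    M : Vec (Vec Bool (suc (m ℕ.* 2))) k
    M = transpose C

    columns∈A : ∀ {c} → c ∈ᵥ transpose M → A c ≡ true
    columns∈A = VecAll.lookup (subst (VecAll.All _) (sym (transpose-involutive C)) (s₀∈A ∷ flattenPadded-All s₀∈A m ps⊆A))

    row≤0 : ∀ i → altSum 1 (Vec.map (λ c → lookup c i) C) ≤ 0ℤ
    row≤0 i = subst (_≤ 0ℤ) (sym (cong₂ _+_ (sgn-odd (lookup s₀ i)) (altSum-flattenPadded m ps i len≤m)))
      (ℤ.+-mono-≤ (sign≤1 (not (lookup s₀ i))) (ℤ.i<j⇒i≤pred[j] (ps<0 i)))
      where
      sign≤1 : ∀ b → sign b ≤ + 1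
      sign≤1 true  = ℤ.≤-refl
      sign≤1 false = -≤+

    rows-false : ∀ i → lookup (Vec.map (AT _) M) i ≡ false
    rows-false i = trans (Vec.lookup-map i _ M) (trans (cong (AT _) (lookup-transpose C i)) (AT≡false _ (row≤0 i)))

  ¬InfinitelyMany-AT : (A : Pred k) → A s₀ ≡ true → NegativePairing (satisfying A) → ¬ InfinitelyMany A (OR k) AT
  ¬InfinitelyMany-AT A s₀∈A (ps , ps∈S , ps<0) AT∞ with AT∞ (suc (2 ℕ.* length ps))
  ... | _ , N≤ℓ , (m , refl) , _ , AT∈Pol =
    AT∉Pol A s₀∈A {m} ps (ℕ.*-cancelˡ-≤ 2 (ℕ.s≤s⁻¹ N≤ℓ)) (Product.map (∈-satisfying⁻ A) (∈-satisfying⁻ A) ∘ ps∈S) ps<0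
      (subst (λ n → IsPolymorphism A (OR k) (AT (suc n))) (ℕ.*-comm 2 m) AT∈Pol)

lemma4p11 : (k : ℕ) (A : Pred k) → IsPredicate A →
    InfinitelyMany A (OR k) AT →
    InfinitelyMany A (OR k) Maj ⊎ InfinitelyMany A (OR k) negMaj
lemma4p11 k A ((s₀ , s₀∈A) , _) AT∞
  with ville k (λ a → sign ∘ lookup a) (satisfying A) | ville k (λ a → sign ∘ not ∘ lookup a) (satisfying A)
... | inj₁ solution | _             = inj₁ (everyOdd⇒InfinitelyMany {B = OR k} Maj (Maj∈Pol A solution))
... | inj₂ _        | inj₁ solution = inj₂ (everyOdd⇒InfinitelyMany {B = OR k} negMaj (negMaj∈Pol A solution))
... | inj₂ combP    | inj₂ combQ    = ⊥-elim (¬InfinitelyMany-AT s₀ A s₀∈A (balancedPairs combP combQ) AT∞)
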